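{- Let $\mathcal{K}=(\Sigma,\to,\ell)$ be a Kripke structure and let $\mathcal{P}=\langle P,\trianglelefteq\rangle$ be a preorder PR on $\Sigma$ (i.e. $\trianglelefteq$ is reflexive and transitive on $P$). Then the relation $\mathrm{Rel}(\mathcal{P})=\{(s,t)\in\Sigma\times\Sigma \mid P(s)\trianglelefteq P(t)\}$ is a simulation on $\mathcal{K}$ if and only if all of the following hold: (i) for all $B,C\in P$ with $B\trianglelefteq C$, all $b\in B$ and all $c\in C$, we have $\ell(b)=\ell(c)$; (ii) for all $B,C,D\in P$, if $B\to^{\exists} C$ and $B\trianglelefteq D$ then $D\to^{\exists}\mu_{\mathcal{P}}(C)$; (iii) for every $C\in P$, $\mathrm{Split}(P,\mathrm{pre}(\mu_{\mathcal{P}}(C)))=P$, i.e. every block of $P$ is either contained in or disjoint from $\mathrm{pre}(\mu_{\mathcal{P}}(C))$.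
   Context: A Kripke structure $(\Sigma,\to,\ell)$ over a set of atoms $AP$ consists of a set of states $\Sigma$, a transition relation $\to\subseteq\Sigma\times\Sigma$ and a labeling $\ell:\Sigma\to\wp(AP)$. A relation $R\subseteq\Sigma\times\Sigma$ is a simulation if whenever $(s,s')\in R$: $\ell(s)=\ell(s')$, and for every $t$ with $s\to t$ there is $t'$ with $s'\to t'$ and $(t,t')\in R$. A partition-relation pair (PR) $\langle P,\trianglelefteq\rangle$ is a partition $P$ of $\Sigma$ together with a binary relation $\trianglelefteq\subseteq P\times P$; it is a preorder PR if $\trianglelefteq$ is a preorder. $P(s)$ denotes the block of $P$ containing $s$. $\mathrm{pre}(T)=\{s\in\Sigma\mid \exists t\in T.\ s\to t\}$. For $S_1,S_2\subseteq\Sigma$, $S_1\to^{\exists}S_2$ means there exist $s_1\in S_1$, $s_2\in S_2$ with $s_1\to s_2$. For $X\subseteq\Sigma$, $\mu_{\mathcal{P}}(X)=\bigcup\{C\in P\mid \exists s\in X.\ P(s)\trianglelefteq C\}$. For $S\subseteq\Sigma$, $\mathrm{Split}(P,S)$ is the partition obtained by replacing each block $B\in P$ by the nonempty sets among $B\cap S$ and $B\setminus S$. -}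

module Defs where

open import Level using (0ℓ)
open import Data.Product using (Σ; ∃; _×_; _,_)
open import Relation.Binary.PropositionalEquality using (_≡_)
open import Relation.Unary using (Pred; _∈_; _∉_; _⊆_; _≐_)

record Kripke (AP : Set) : Set₁ where
  field
    State : Set
    _⟶_   : State → State → Set
    label : State → Pred AP 0ℓ

-- The partition P is given by its set of blocks (type Block) together with the
-- map blk : S → Block sending s to its block P(s); blocks are nonempty.
record PR (S : Set) : Set₁ where
  field
    Block    : Set
    blk      : S → Block
    nonempty : ∀ (B : Block) → ∃ λ s → blk s ≡ B
    _⊴_      : Block → Block → Set

  ⟦_⟧ : Block → Pred S 0ℓ
  ⟦ B ⟧ s = blk s ≡ B

module _ {AP : Set} (K : Kripke AP) where
  open Kripke K

  IsSimulation : (State → State → Set) → Set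
  IsSimulation R =
    ∀ s s' → R s s' →
      (label s ≐ label s') ×
      (∀ t → s ⟶ t → ∃ λ t' → (s' ⟶ t') × R t t')

  pre : Pred State 0ℓ → Pred State 0ℓ
  pre T s = ∃ λ t → (s ⟶ t) × (t ∈ T)

  _→∃_ : Pred State 0ℓ → Pred State 0ℓ → Set
  S₁ →∃ S₂ = ∃ λ s₁ → ∃ λ s₂ → (s₁ ∈ S₁) × (s₂ ∈ S₂) × (s₁ ⟶ s₂)

  module _ (𝒫 : PR State) where
    open PR 𝒫

    Rel : State → State → Set
    Rel s t = blk s ⊴ blk t

    -- μ_𝒫(X) = ⋃ { C ∈ P | ∃ x ∈ X. P(x) ⊴ C };  s belongs to it iff
    -- ∃ x ∈ X with P(x) ⊴ P(s).
    μ : Pred State 0ℓ → Pred State 0ℓ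
    μ X s = ∃ λ x → (x ∈ X) × (blk x ⊴ blk s)

    -- Split(P, T) = P : every block of P is either contained in or disjoint
    -- from T, i.e. every block meeting T is contained in T.
    SplitIsIdentity : Pred State 0ℓ → Set
    SplitIsIdentity T = ∀ (B : Block) → (∃ λ s → (s ∈ ⟦ B ⟧) × (s ∈ T)) → ⟦ B ⟧ ⊆ T

    Cond-i : Set
    Cond-i = ∀ (B C : Block) → B ⊴ C → ∀ b c → b ∈ ⟦ B ⟧ → c ∈ ⟦ C ⟧ → label b ≐ label c

    Cond-ii : Set
    Cond-ii = ∀ (B C D : Block) → ⟦ B ⟧ →∃ ⟦ C ⟧ → B ⊴ D → ⟦ D ⟧ →∃ μ ⟦ C ⟧

    Cond-iii : Set
    Cond-iii = ∀ (C : Block) → SplitIsIdentity (pre (μ ⟦ C ⟧))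

-- Throughout, μ ⟦ C ⟧ is the up-closure of a block C: a state t lies in it
-- exactly when C ⊴ P(t).  With this description in hand both directions are
-- direct unfoldings of the simulation game.
--
--  * Simulation ⇒ (i),(ii),(iii).  (i) is the label clause of the simulation
--    for related states.  (ii): a witness d of block D must answer a move
--    B →∃ C, landing in μ(C).  (iii): a state s' in the same block as some
--    s ∈ pre(μ C) is related to s (reflexivity), so it answers s's move, and
--    μ(C) is closed upward along Rel (transitivity).
--  * (i),(ii),(iii) ⇒ simulation.  Labels come from (i).  For s → t and
--    P(s) ⊴ P(s'), condition (ii) gives some state of P(s') in pre(μ P(t));
--    by (iii) the whole block P(s'), hence s' itself, lies in pre(μ P(t)),
--    which is exactly a matching move.  This direction needs no preorder.
module Submission where

open import Defs
open import Data.Product using (∃; _×_; _,_; proj₁; proj₂)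
open import Relation.Binary.PropositionalEquality using (_≡_; refl; sym)
open import Relation.Binary.Structures using (IsPreorder)
open import Function.Bundles using (_⇔_; mk⇔)
open import Relation.Unary using (_∈_)
open import Relation.Binary.Definitions using (Transitive)

module _ {AP : Set} (K : Kripke AP) (𝒫 : PR (Kripke.State K)) where
  open Kripke K
  open PR 𝒫

  -- Membership in the up-closure of a block C is C ⊴ P(t); the converse
  -- direction uses that blocks are nonempty.
  μ-block⇒⊴ : ∀ {C t} → t ∈ μ K 𝒫 ⟦ C ⟧ → C ⊴ blk t
  μ-block⇒⊴ (x , refl , x⊴t) = x⊴t

  ⊴⇒μ-block : ∀ {C t} → C ⊴ blk t → t ∈ μ K 𝒫 ⟦ C ⟧
  ⊴⇒μ-block {C} C⊴t with nonempty C
  ... | x , refl = x , refl , C⊴t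

  μ-up-closed : Transitive _⊴_ →
                ∀ {X t t'} → t ∈ μ K 𝒫 X → Rel K 𝒫 t t' → t' ∈ μ K 𝒫 X
  μ-up-closed ⊴-trans (x , x∈X , x⊴t) t⊴t' = x , x∈X , ⊴-trans x⊴t t⊴t'

  module FromSimulation (sim : IsSimulation K (Rel K 𝒫)) where

    labels-agree : Cond-i K 𝒫
    labels-agree B C B⊴C b c refl refl = proj₁ (sim b c B⊴C)

    moves-answered : Cond-ii K 𝒫
    moves-answered B C D (s , t , refl , refl , s⟶t) B⊴D with nonempty D
    ... | d , refl with proj₂ (sim s d B⊴D) t s⟶t
    ... | t' , d⟶t' , t⊴t' = d , t' , refl , ⊴⇒μ-block t⊴t' , d⟶t'

    pre-μ-saturated : IsPreorder _≡_ _⊴_ → Cond-iii K 𝒫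
    pre-μ-saturated pre⊴ C B (s , refl , t , s⟶t , t∈μC) {s'} s'∈B
      with proj₂ (sim s s' (IsPreorder.reflexive pre⊴ (sym s'∈B))) t s⟶t
    ... | t' , s'⟶t' , t⊴t' =
      t' , s'⟶t' , μ-up-closed (IsPreorder.trans pre⊴) t∈μC t⊴t'

  toSimulation : Cond-i K 𝒫 × Cond-ii K 𝒫 × Cond-iii K 𝒫 → IsSimulation K (Rel K 𝒫)
  toSimulation (labels-agree , moves-answered , pre-μ-saturated) s s' s⊴s' =
    labels-agree (blk s) (blk s') s⊴s' s s' refl refl , answer
    where
    answer : ∀ t → s ⟶ t → ∃ λ t' → (s' ⟶ t') × Rel K 𝒫 t t'
    answer t s⟶t
      with moves-answered (blk s) (blk t) (blk s') (s , t , refl , refl , s⟶t) s⊴s'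
    ... | d , u , d∈P[s'] , u∈μP[t] , d⟶u
      with pre-μ-saturated (blk t) (blk s') (d , d∈P[s'] , u , d⟶u , u∈μP[t]) refl
    ... | t' , s'⟶t' , t'∈μP[t] = t' , s'⟶t' , μ-block⇒⊴ t'∈μP[t]

theorem1 : {AP : Set} (K : Kripke AP) (𝒫 : PR (Kripke.State K)) →
    IsPreorder _≡_ (PR._⊴_ 𝒫) →
    IsSimulation K (Rel K 𝒫) ⇔ (Cond-i K 𝒫 × Cond-ii K 𝒫 × Cond-iii K 𝒫)
theorem1 K 𝒫 pre⊴ = mk⇔ conditions (toSimulation K 𝒫)
  where
  conditions : IsSimulation K (Rel K 𝒫) → Cond-i K 𝒫 × Cond-ii K 𝒫 × Cond-iii K 𝒫
  conditions sim = labels-agree , moves-answered , pre-μ-saturated pre⊴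
    where open FromSimulation K 𝒫 sim
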